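{- Let $\mathcal D\in\mathbb N^n$ be a non-increasing degree sequence of some simple graph. Then the oriented graph $G(\mathcal D)$ is connected (its underlying undirected graph is connected) and acyclic.
   Context: $\mathcal M(\mathcal D)$ is the set of symmetric $n\times n$ $(0,1)$-matrices with zero diagonal and row sums $\mathcal D$ (adjacency matrices of simple graphs on vertices $1,\dots,n$ with vertex $i$ of degree $d_i$). For $i<j$, $k<l$, $\mathbf C_{i,j,k,l}$ is the $n\times n$ matrix with entries $+1$ at $(i,k)$ and $(j,l)$, $-1$ at $(i,l)$ and $(j,k)$, $0$ elsewhere, and the symmetric switching matrix is $\mathcal C_{ijkl}=\mathbf C_{i,j,k,l}+{}^t\mathbf C_{i,j,k,l}$, where $i,j,k,l$ are pairwise distinct. A positive switch of coordinates $(i,j,k,l)$ replaces $\mathbf A\in\mathcal M(\mathcal D)$ by $\mathbf A+\mathcal C_{ijkl}$ when the latter is again in $\mathcal M(\mathcal D)$. $G(\mathcal D)$ is the directed graph on $\mathcal M(\mathcal D)$ with an arc $\mathbf A\to\mathbf A'$ when $\mathbf A'$ is obtained from $\mathbf A$ by one positive switch. -}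

module Defs where

open import Data.Nat using (ℕ)
open import Data.Integer using (ℤ; +_; _+_; _-_)
open import Data.Fin using (Fin; _<_; _≤_)
open import Data.Fin.Properties using (_≟_)
open import Data.Vec using (Vec; lookup; tabulate; zipWith; foldr)
open import Data.Product using (_×_; ∃-syntax)
open import Data.Sum using (_⊎_)
open import Relation.Nullary using (¬_; does)
open import Data.Bool using (if_then_else_)
open import Relation.Binary.PropositionalEquality using (_≡_; _≢_)
open import Relation.Binary.Construct.Closure.Transitive using (TransClosure)
open import Relation.Binary.Construct.Closure.Symmetric using (SymClosure)
open import Relation.Binary.Construct.Closure.ReflexiveTransitive using (Star)
import Data.Nat as ℕ

Matrix : ℕ → Set
Matrix n = Vec (Vec ℤ n) n

entry : ∀ {n} → Matrix n → Fin n → Fin n → ℤ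
entry A a b = lookup (lookup A a) b

rowSum : ∀ {n} → Vec ℤ n → ℤ
rowSum = foldr _ _+_ (+ 0)

δ : ∀ {n} → Fin n → Fin n → ℤ
δ a b = if does (a ≟ b) then + 1 else + 0

InM : ∀ {n} → Vec ℕ n → Matrix n → Set
InM {n} D A =
  (∀ a b → entry A a b ≡ + 0 ⊎ entry A a b ≡ + 1) ×
  (∀ a b → entry A a b ≡ entry A b a) ×
  (∀ a → entry A a a ≡ + 0) ×
  (∀ a → rowSum (lookup A a) ≡ + lookup D a)

Graphical : ∀ {n} → Vec ℕ n → Set
Graphical D = ∃[ A ] InM D A

NonIncreasing : ∀ {n} → Vec ℕ n → Set
NonIncreasing D = ∀ a b → a ≤ b → lookup D b ℕ.≤ lookup D a

Cbold : ∀ {n} → Fin n → Fin n → Fin n → Fin n → Matrix n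
Cbold i j k l = tabulate λ a → tabulate λ b →
  ((δ a i Data.Integer.* δ b k) + (δ a j Data.Integer.* δ b l))
  - ((δ a i Data.Integer.* δ b l) + (δ a j Data.Integer.* δ b k))

transpose : ∀ {n} → Matrix n → Matrix n
transpose A = tabulate λ a → tabulate λ b → entry A b a

_⊕_ : ∀ {n} → Matrix n → Matrix n → Matrix n
A ⊕ B = zipWith (zipWith _+_) A B

Csym : ∀ {n} → Fin n → Fin n → Fin n → Fin n → Matrix n
Csym i j k l = Cbold i j k l ⊕ transpose (Cbold i j k l)

Coords : ∀ {n} → Fin n → Fin n → Fin n → Fin n → Set
Coords i j k l = i < j × k < l × i ≢ k × i ≢ l × j ≢ k × j ≢ l

Arc : ∀ {n} → Vec ℕ n → Matrix n → Matrix n → Set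
Arc D A A' = InM D A × InM D A' ×
  ∃[ i ] ∃[ j ] ∃[ k ] ∃[ l ] (Coords i j k l × A' ≡ A ⊕ Csym i j k l)

Connected : ∀ {n} → Vec ℕ n → Set
Connected D = ∀ A B → InM D A → InM D B → Star (SymClosure (Arc D)) A B

Acyclic : ∀ {n} → Vec ℕ n → Set
Acyclic D = ∀ A → ¬ TransClosure (Arc D) A A

-- Acyclicity: weighting the entry (x, y) by x·y gives a potential that the positive switch with
-- coordinates (i, j, k, l) raises by 2(j - i)(l - k) > 0, so it strictly increases along every arc.
--
-- Connectivity holds for every D. Let A, B ∈ M(D)
-- agree on the rows (hence, by symmetry, the columns) below r. While row r differs, say A r b = 1 and
-- B r b = 0, equal row sums give c with A r c = 0 and B r c = 1, and a counting argument gives d ≥ r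
-- with A c d = 1, A b d = 0 or with B b d = 1, B c d = 0. Switching A on the edges rb, cd (or B on
-- rc, bd) corrects the entries (r, b) and (r, c) of row r and leaves the rows below r alone.

module Submission where

open import Defs
open import Data.Nat using (ℕ)
open import Data.Vec using (Vec)
open import Data.Product using (_×_)

import Data.Nat as ℕ
import Data.Nat.Properties as ℕP
open import Data.Integer using (ℤ; +_; -_; _+_; _-_; _*_; _≤_; _<_; +≤+; +<+)
import Data.Integer.Properties as ℤP
open import Data.Integer.Tactic.RingSolver using (solve-∀)
open import Data.Fin as Fin using (Fin; toℕ; punchIn)
import Data.Fin.Properties as FinP
open import Data.Vec using ([]; _∷_; lookup; tabulate; zipWith)
import Data.Vec.Properties as VecP
open import Data.Product using (∃-syntax; _,_; proj₁; proj₂)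
open import Data.Sum as Sum using (_⊎_; inj₁; inj₂)
open import Data.Bool using (if_then_else_)
open import Relation.Nullary using (¬_; Dec; yes; no; does; contradiction)
open import Relation.Nullary.Decidable using (dec-true; dec-false; _×-dec_; _⊎-dec_; ¬?)
open import Relation.Binary.PropositionalEquality
open import Function using (_∘_)
open import Relation.Binary.Construct.Closure.Transitive using (TransClosure; [_]; _∷_)
open import Relation.Binary.Construct.Closure.Symmetric as SymClosure using (SymClosure; fwd; bwd)
open import Relation.Binary.Construct.Closure.ReflexiveTransitive using (Star; ε; _◅_; _◅◅_; reverse)
open import Relation.Binary.Definitions using (tri<; tri≈; tri>)

open import Algebra.Properties.Semiring.Sum ℤP.+-*-semiring
  using (sum; sum-cong-≗; sum-replicate-zero; sum-remove; ∑-distrib-+; *-distribˡ-sum; *-distribʳ-sum)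
import Algebra.Properties.Semiring.Sum ℕP.+-*-semiring as ℕΣ

∑-distrib-- : ∀ {n} (f g : Fin n → ℤ) → sum (λ i → f i - g i) ≡ sum f - sum g
∑-distrib-- {ℕ.zero} f g = refl
∑-distrib-- {ℕ.suc n} f g =
  trans (cong (_+_ (f Fin.zero - g Fin.zero)) (∑-distrib-- (λ i → f (Fin.suc i)) (λ i → g (Fin.suc i))))
        (regroup (f Fin.zero) (g Fin.zero) _ _)
  where
  regroup : ∀ a b c d → (a - b) + (c - d) ≡ (a + c) - (b + d)
  regroup = solve-∀

∑-nonneg : ∀ {n} (f : Fin n → ℤ) → (∀ i → + 0 ≤ f i) → + 0 ≤ sum f
∑-nonneg {ℕ.zero} f h = ℤP.≤-refl
∑-nonneg {ℕ.suc n} f h = ℤP.+-mono-≤ (h Fin.zero) (∑-nonneg _ (λ i → h (Fin.suc i)))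

≤-+-nonneg : ∀ i {j} → + 0 ≤ j → i ≤ i + j
≤-+-nonneg i 0≤j = subst (_≤ i + _) (ℤP.+-identityʳ i) (ℤP.+-monoʳ-≤ i 0≤j)

point≤∑ : ∀ {n} (f : Fin n → ℤ) (x : Fin n) → (∀ z → z ≢ x → + 0 ≤ f z) → f x ≤ sum f
point≤∑ {ℕ.suc n} f x nonneg =
  subst (f x ≤_) (sym (sum-remove {i = x} f))
        (≤-+-nonneg (f x) (∑-nonneg _ (λ j → nonneg (punchIn x j) (FinP.punchInᵢ≢i x j))))

∑∑-product : ∀ {n} (f g : Fin n → ℤ) → sum (λ x → sum (λ y → f x * g y)) ≡ sum f * sum g
∑∑-product f g = begin
  sum (λ x → sum (λ y → f x * g y))   ≡⟨ sum-cong-≗ (λ x → *-distribˡ-sum (f x) g) ⟨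
  sum (λ x → f x * sum g)             ≡⟨ *-distribʳ-sum (sum g) f ⟨
  sum f * sum g                       ∎
  where open ≡-Reasoning

δ-refl : ∀ {n} (x : Fin n) → δ x x ≡ + 1
δ-refl x = cong (if_then + 1 else + 0) (dec-true (x FinP.≟ x) refl)

δ-≢ : ∀ {n} {x y : Fin n} → x ≢ y → δ x y ≡ + 0
δ-≢ {x = x} {y} x≢y = cong (if_then + 1 else + 0) (dec-false (x FinP.≟ y) x≢y)

∑-δ : ∀ {n} (k : Fin n) (g : Fin n → ℤ) → sum (λ y → δ y k * g y) ≡ g k
∑-δ {ℕ.suc n} Fin.zero g =
  trans (cong₂ _+_ (ℤP.*-identityˡ (g Fin.zero)) (sum-replicate-zero n)) (ℤP.+-identityʳ (g Fin.zero))
∑-δ {ℕ.suc n} (Fin.suc k) g = trans (ℤP.+-identityˡ _) (∑-δ k (g ∘ Fin.suc))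

dipole : ∀ {n} → Fin n → Fin n → Fin n → ℤ
dipole i j x = δ x i - δ x j

dipole-outside : ∀ {n} {i j x : Fin n} → x ≢ i → x ≢ j → dipole i j x ≡ + 0
dipole-outside x≢i x≢j = cong₂ _-_ (δ-≢ x≢i) (δ-≢ x≢j)

∑-dipole : ∀ {n} (i j : Fin n) (g : Fin n → ℤ) → sum (λ x → dipole i j x * g x) ≡ g i - g j
∑-dipole i j g = begin
  sum (λ x → dipole i j x * g x)
    ≡⟨ sum-cong-≗ (λ x → expand (δ x i) (δ x j) (g x)) ⟩
  sum (λ x → δ x i * g x - δ x j * g x)
    ≡⟨ ∑-distrib-- (λ x → δ x i * g x) (λ x → δ x j * g x) ⟩
  sum (λ x → δ x i * g x) - sum (λ x → δ x j * g x)
    ≡⟨ cong₂ _-_ (∑-δ i g) (∑-δ j g) ⟩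
  g i - g j
    ∎
  where
  open ≡-Reasoning
  expand : ∀ a b c → (a - b) * c ≡ a * c - b * c
  expand = solve-∀

-- Moving the value at y onto x preserves the sum, so x and y together act as one non-negative point.
point≤∑-merging : ∀ {n} (f : Fin n → ℤ) {r x y : Fin n} → x ≢ y → r ≢ x → r ≢ y →
                  + 0 ≤ f x + f y → (∀ z → z ≢ r → z ≢ x → z ≢ y → + 0 ≤ f z) → f r ≤ sum f
point≤∑-merging f {r} {x} {y} x≢y r≢x r≢y pair nonneg = subst₂ _≤_ g-at-r ∑g≡∑f (point≤∑ g r g-nonneg)
  where
  g : Fin _ → ℤ
  g z = f z + dipole x y z * f y
  g-at : ∀ z {d} → dipole x y z ≡ d → g z ≡ f z + d * f y
  g-at z dipole≡d = cong (λ d → f z + d * f y) dipole≡d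
  ∑g≡∑f : sum g ≡ sum f
  ∑g≡∑f = begin
    sum g                                            ≡⟨ ∑-distrib-+ f (λ z → dipole x y z * f y) ⟩
    sum f + sum (λ z → dipole x y z * f y)           ≡⟨ cong (_+_ (sum f)) (∑-dipole x y (λ _ → f y)) ⟩
    sum f + (f y - f y)                              ≡⟨ cong (_+_ (sum f)) (ℤP.+-inverseʳ (f y)) ⟩
    sum f + + 0                                      ≡⟨ ℤP.+-identityʳ (sum f) ⟩
    sum f                                            ∎
    where open ≡-Reasoning
  g-at-r : g r ≡ f r
  g-at-r = trans (g-at r (dipole-outside r≢x r≢y)) (ℤP.+-identityʳ (f r))
  vanish : ∀ a → a + (+ 0 - + 1) * a ≡ + 0
  vanish = solve-∀
  g-nonneg : ∀ z → z ≢ r → + 0 ≤ g z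
  g-nonneg z z≢r = by-cases (z FinP.≟ x) (z FinP.≟ y)
    where
    by-cases : Dec (z ≡ x) → Dec (z ≡ y) → + 0 ≤ g z
    by-cases (yes refl) (yes z≡y) = contradiction z≡y x≢y
    by-cases (yes refl) (no _) = subst (+ 0 ≤_) (sym g-at-x) pair
      where
      g-at-x : g x ≡ f x + f y
      g-at-x = trans (g-at x (cong₂ _-_ (δ-refl x) (δ-≢ x≢y))) (cong (_+_ (f x)) (ℤP.*-identityˡ (f y)))
    by-cases (no z≢x) (yes refl) =
      ℤP.≤-reflexive (sym (trans (g-at y (cong₂ _-_ (δ-≢ z≢x) (δ-refl y))) (vanish (f y))))
    by-cases (no z≢x) (no z≢y) =
      subst (+ 0 ≤_) (sym (trans (g-at z (dipole-outside z≢x z≢y)) (ℤP.+-identityʳ (f z))))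
            (nonneg z z≢r z≢x z≢y)

ℕ∑-mono-≤ : ∀ {n} {f g : Fin n → ℕ} → (∀ i → f i ℕ.≤ g i) → ℕΣ.sum f ℕ.≤ ℕΣ.sum g
ℕ∑-mono-≤ {ℕ.zero} f≤g = ℕ.z≤n
ℕ∑-mono-≤ {ℕ.suc n} f≤g = ℕP.+-mono-≤ (f≤g Fin.zero) (ℕ∑-mono-≤ (f≤g ∘ Fin.suc))

ℕ∑-mono-< : ∀ {n} {f g : Fin n → ℕ} (b : Fin n) → (∀ i → f i ℕ.≤ g i) → f b ℕ.< g b →
            ℕΣ.sum f ℕ.< ℕΣ.sum g
ℕ∑-mono-< Fin.zero f≤g fb<gb = ℕP.+-mono-<-≤ fb<gb (ℕ∑-mono-≤ (f≤g ∘ Fin.suc))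
ℕ∑-mono-< (Fin.suc b) f≤g fb<gb = ℕP.+-mono-≤-< (f≤g Fin.zero) (ℕ∑-mono-< b (f≤g ∘ Fin.suc) fb<gb)

Bit : ℤ → Set
Bit z = z ≡ + 0 ⊎ z ≡ + 1

bit-difference-nonneg : ∀ {a b} → Bit a → Bit b → ¬ (a ≡ + 0 × b ≡ + 1) → + 0 ≤ a - b
bit-difference-nonneg (inj₁ refl) (inj₁ refl) _ = ℤP.≤-refl
bit-difference-nonneg (inj₁ refl) (inj₂ refl) ¬01 = contradiction (refl , refl) ¬01
bit-difference-nonneg (inj₂ refl) (inj₁ refl) _ = +≤+ ℕ.z≤n
bit-difference-nonneg (inj₂ refl) (inj₂ refl) _ = ℤP.≤-refl

opposite-bit : ∀ {n} (u v : Fin n → ℤ) {b : Fin n} → (∀ y → Bit (u y)) → (∀ y → Bit (v y)) →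
               sum u ≡ sum v → u b ≡ + 1 → v b ≡ + 0 → ∃[ c ] (u c ≡ + 0 × v c ≡ + 1)
opposite-bit u v {b} u-bits v-bits ∑u≡∑v ub≡1 vb≡0
  with FinP.any? (λ c → (u c ℤP.≟ + 0) ×-dec (v c ℤP.≟ + 1))
... | yes found = found
... | no none = contradiction (subst₂ _≤_ (cong₂ _-_ ub≡1 vb≡0) ∑[u-v]≡0 b-below-sum) λ { (+≤+ ()) }
  where
  ∑[u-v]≡0 : sum (λ y → u y - v y) ≡ + 0
  ∑[u-v]≡0 = trans (∑-distrib-- u v) (trans (cong (_- sum v) ∑u≡∑v) (ℤP.+-inverseʳ (sum v)))
  b-below-sum : u b - v b ≤ sum (λ y → u y - v y)
  b-below-sum = point≤∑ (λ y → u y - v y) b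
    (λ y _ → bit-difference-nonneg (u-bits y) (v-bits y) (λ u0v1 → none (y , u0v1)))

0≢1 : + 0 ≢ + 1
0≢1 ()

1≢0-at : ∀ {a b : ℤ} → a ≡ + 1 → b ≡ + 0 → a ≢ b
1≢0-at refl refl ()

≢-by-values : ∀ {n} (u : Fin n → ℤ) {x y : Fin n} {a b : ℤ} → u x ≡ a → u y ≡ b → a ≢ b → x ≢ y
≢-by-values u ux≡a uy≡b a≢b refl = a≢b (trans (sym ux≡a) uy≡b)

mismatch : ∀ {n} → (Fin n → ℤ) → (Fin n → ℤ) → Fin n → ℕ
mismatch u v y = if does (u y ℤP.≟ v y) then 0 else 1

hamming : ∀ {n} → (Fin n → ℤ) → (Fin n → ℤ) → ℕ
hamming u v = ℕΣ.sum (mismatch u v)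

mismatch-≡ : ∀ {n} {u v : Fin n → ℤ} {y} → u y ≡ v y → mismatch u v y ≡ 0
mismatch-≡ {u = u} {v} {y} uy≡vy = cong (if_then 0 else 1) (dec-true (u y ℤP.≟ v y) uy≡vy)

mismatch-≢ : ∀ {n} {u v : Fin n → ℤ} {y} → u y ≢ v y → mismatch u v y ≡ 1
mismatch-≢ {u = u} {v} {y} uy≢vy = cong (if_then 0 else 1) (dec-false (u y ℤP.≟ v y) uy≢vy)

mismatch-comm : ∀ {n} (u v : Fin n → ℤ) y → mismatch u v y ≡ mismatch v u y
mismatch-comm u v y with u y ℤP.≟ v y
... | yes uy≡vy = sym (mismatch-≡ {u = v} {u} (sym uy≡vy))
... | no uy≢vy = sym (mismatch-≢ {u = v} {u} (uy≢vy ∘ sym))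

hamming-comm : ∀ {n} (u v : Fin n → ℤ) → hamming u v ≡ hamming v u
hamming-comm u v = ℕΣ.sum-cong-≗ (mismatch-comm u v)

hamming-repair : ∀ {n} {u u' v : Fin n → ℤ} {b c : Fin n} → (∀ y → y ≢ b → y ≢ c → u' y ≡ u y) →
                 u' b ≡ v b → u' c ≡ v c → u b ≢ v b → hamming u' v ℕ.< hamming u v
hamming-repair {u = u} {u'} {v} {b} {c} elsewhere u'b≡vb u'c≡vc ub≢vb =
  ℕ∑-mono-< b pointwise
    (subst₂ ℕ._<_ (sym (mismatch-≡ {u = u'} {v} u'b≡vb)) (sym (mismatch-≢ {u = u} {v} ub≢vb)) ℕP.0<1+n)
  where
  pointwise : ∀ y → mismatch u' v y ℕ.≤ mismatch u v y
  pointwise y with y FinP.≟ b | y FinP.≟ c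
  ... | yes refl | _ = ℕP.≤-trans (ℕP.≤-reflexive (mismatch-≡ {u = u'} {v} u'b≡vb)) ℕ.z≤n
  ... | no _ | yes refl = ℕP.≤-trans (ℕP.≤-reflexive (mismatch-≡ {u = u'} {v} u'c≡vc)) ℕ.z≤n
  ... | no y≢b | no y≢c = ℕP.≤-reflexive (cong (λ w → mismatch (λ _ → w) v y) (elsewhere y y≢b y≢c))

entry-⊕ : ∀ {n} (A B : Matrix n) x y → entry (A ⊕ B) x y ≡ entry A x y + entry B x y
entry-⊕ A B x y = trans (cong (λ row → lookup row y) (VecP.lookup-zipWith (zipWith _+_) x A B))
                        (VecP.lookup-zipWith _+_ y (lookup A x) (lookup B x))

entry-tabulate : ∀ {n} (f : Fin n → Fin n → ℤ) x y → entry (tabulate λ a → tabulate (f a)) x y ≡ f x y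
entry-tabulate f x y =
  trans (cong (λ row → lookup row y) (VecP.lookup∘tabulate _ x)) (VecP.lookup∘tabulate _ y)

≡-by-entries : ∀ {n} {A B : Matrix n} → (∀ x y → entry A x y ≡ entry B x y) → A ≡ B
≡-by-entries {A = A} {B} same = begin
  A                                       ≡⟨ tabulate-entries A ⟨
  tabulate (λ x → tabulate (entry A x))   ≡⟨ VecP.tabulate-cong (λ x → VecP.tabulate-cong (same x)) ⟩
  tabulate (λ x → tabulate (entry B x))   ≡⟨ tabulate-entries B ⟩
  B                                       ∎
  where
  open ≡-Reasoning
  tabulate-entries : ∀ C → tabulate (λ x → tabulate (entry C x)) ≡ C
  tabulate-entries C =
    trans (VecP.tabulate-cong (λ x → VecP.tabulate∘lookup (lookup C x))) (VecP.tabulate∘lookup C)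

rowSum≡∑ : ∀ {n} (v : Vec ℤ n) → rowSum v ≡ sum (lookup v)
rowSum≡∑ [] = refl
rowSum≡∑ (x ∷ v) = cong (_+_ x) (rowSum≡∑ v)

module Member {n} {D : Vec ℕ n} {A : Matrix n} (A∈M : InM D A) where

  bit : ∀ x y → Bit (entry A x y)
  bit = proj₁ A∈M

  symmetric : ∀ x y → entry A x y ≡ entry A y x
  symmetric = proj₁ (proj₂ A∈M)

  diagonal : ∀ x → entry A x x ≡ + 0
  diagonal = proj₁ (proj₂ (proj₂ A∈M))

  degree : ∀ x → sum (entry A x) ≡ + lookup D x
  degree x = trans (sym (rowSum≡∑ (lookup A x))) (proj₂ (proj₂ (proj₂ A∈M)) x)

csym : ∀ {n} → Fin n → Fin n → Fin n → Fin n → Fin n → Fin n → ℤ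
csym i j k l x y = dipole i j x * dipole k l y + dipole i j y * dipole k l x

entry-Cbold : ∀ {n} (i j k l : Fin n) x y → entry (Cbold i j k l) x y ≡ dipole i j x * dipole k l y
entry-Cbold i j k l x y = trans (entry-tabulate _ x y) (factor (δ x i) (δ x j) (δ y k) (δ y l))
  where
  factor : ∀ xi xj yk yl → (xi * yk + xj * yl) - (xi * yl + xj * yk) ≡ (xi - xj) * (yk - yl)
  factor = solve-∀

entry-Csym : ∀ {n} (i j k l : Fin n) x y → entry (Csym i j k l) x y ≡ csym i j k l x y
entry-Csym i j k l x y =
  trans (entry-⊕ (Cbold i j k l) _ x y)
        (cong₂ _+_ (entry-Cbold i j k l x y)
                   (trans (entry-tabulate (λ a b → entry (Cbold i j k l) b a) x y) (entry-Cbold i j k l y x)))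

entry-⊕-Csym : ∀ {n} (A : Matrix n) (i j k l : Fin n) x y →
               entry (A ⊕ Csym i j k l) x y ≡ entry A x y + csym i j k l x y
entry-⊕-Csym A i j k l x y = trans (entry-⊕ A _ x y) (cong (_+_ (entry A x y)) (entry-Csym i j k l x y))

∑-csym : ∀ {n} (i j k l x : Fin n) → sum (csym i j k l x) ≡ + 0
∑-csym i j k l x = begin
  sum (csym i j k l x)
    ≡⟨ sum-cong-≗ (λ y → cong (_+ dipole i j y * b) (ℤP.*-comm a (dipole k l y))) ⟩
  sum (λ y → dipole k l y * a + dipole i j y * b)
    ≡⟨ ∑-distrib-+ (λ y → dipole k l y * a) (λ y → dipole i j y * b) ⟩
  sum (λ y → dipole k l y * a) + sum (λ y → dipole i j y * b)
    ≡⟨ cong₂ _+_ (∑-dipole k l (λ _ → a)) (∑-dipole i j (λ _ → b)) ⟩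
  (a - a) + (b - b)
    ≡⟨ cong₂ _+_ (ℤP.+-inverseʳ a) (ℤP.+-inverseʳ b) ⟩
  + 0
    ∎
  where
  open ≡-Reasoning
  a = dipole i j x
  b = dipole k l x

⊕-Csym-sym : ∀ {n} {A : Matrix n} → (∀ x y → entry A x y ≡ entry A y x) →
             ∀ i j k l x y → entry (A ⊕ Csym i j k l) x y ≡ entry (A ⊕ Csym i j k l) y x
⊕-Csym-sym {A = A} A-sym i j k l x y =
  trans (entry-⊕-Csym A i j k l x y)
        (trans (cong₂ _+_ (A-sym x y) (ℤP.+-comm (dipole i j x * dipole k l y) _))
               (sym (entry-⊕-Csym A i j k l y x)))

⊕-Csym-rowSum : ∀ {n} (A : Matrix n) (i j k l x : Fin n) →
                sum (entry (A ⊕ Csym i j k l) x) ≡ sum (entry A x)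
⊕-Csym-rowSum A i j k l x = begin
  sum (entry (A ⊕ Csym i j k l) x)                        ≡⟨ sum-cong-≗ (entry-⊕-Csym A i j k l x) ⟩
  sum (λ y → entry A x y + csym i j k l x y)              ≡⟨ ∑-distrib-+ (entry A x) (csym i j k l x) ⟩
  sum (entry A x) + sum (csym i j k l x)                  ≡⟨ cong (_+_ (sum (entry A x))) (∑-csym i j k l x) ⟩
  sum (entry A x) + + 0                                   ≡⟨ ℤP.+-identityʳ _ ⟩
  sum (entry A x)                                         ∎
  where open ≡-Reasoning

csym-outside-row : ∀ {n} (i j k l : Fin n) x y →
                   dipole i j x ≡ + 0 → dipole k l x ≡ + 0 → csym i j k l x y ≡ + 0
csym-outside-row i j k l x y ij≡0 kl≡0 =
  trans (cong₂ (λ a b → a * dipole k l y + dipole i j y * b) ij≡0 kl≡0)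
        (trans (ℤP.+-identityˡ _) (ℤP.*-zeroʳ (dipole i j y)))

csym-outside-pair : ∀ {n} (i j k l : Fin n) x y →
                    dipole k l x ≡ + 0 → dipole k l y ≡ + 0 → csym i j k l x y ≡ + 0
csym-outside-pair i j k l x y klx≡0 kly≡0 =
  trans (cong₂ (λ a b → dipole i j x * a + dipole i j y * b) kly≡0 klx≡0)
        (cong₂ _+_ (ℤP.*-zeroʳ (dipole i j x)) (ℤP.*-zeroʳ (dipole i j y)))

⊕-cancel : ∀ {n} (A C C' : Matrix n) → (∀ x y → entry C' x y ≡ - entry C x y) → (A ⊕ C) ⊕ C' ≡ A
⊕-cancel A C C' opposite = ≡-by-entries λ x y → begin
  entry ((A ⊕ C) ⊕ C') x y                        ≡⟨ entry-⊕ (A ⊕ C) C' x y ⟩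
  entry (A ⊕ C) x y + entry C' x y                ≡⟨ cong₂ _+_ (entry-⊕ A C x y) (opposite x y) ⟩
  (entry A x y + entry C x y) + - entry C x y     ≡⟨ cancel (entry A x y) (entry C x y) ⟩
  entry A x y                                     ∎
  where
  open ≡-Reasoning
  cancel : ∀ a c → (a + c) + - c ≡ a
  cancel = solve-∀

module _ {n} (i j k l : Fin n) where

  Csym-flip-both : Csym j i l k ≡ Csym i j k l
  Csym-flip-both = ≡-by-entries λ x y →
    trans (entry-Csym j i l k x y) (trans (ring (δ x i) (δ x j) (δ x k) (δ x l) (δ y i) (δ y j) (δ y k) (δ y l))
                                          (sym (entry-Csym i j k l x y)))
    where
    ring : ∀ xi xj xk xl yi yj yk yl →
      (xj - xi) * (yl - yk) + (yj - yi) * (xl - xk) ≡ (xi - xj) * (yk - yl) + (yi - yj) * (xk - xl)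
    ring = solve-∀

  ⊕-Csym-flipˡ-cancel : ∀ A → (A ⊕ Csym i j k l) ⊕ Csym j i k l ≡ A
  ⊕-Csym-flipˡ-cancel A = ⊕-cancel A (Csym i j k l) (Csym j i k l) λ x y →
    trans (entry-Csym j i k l x y) (trans (ring (δ x i) (δ x j) (δ x k) (δ x l) (δ y i) (δ y j) (δ y k) (δ y l))
                                          (cong -_ (sym (entry-Csym i j k l x y))))
    where
    ring : ∀ xi xj xk xl yi yj yk yl →
      (xj - xi) * (yk - yl) + (yj - yi) * (xk - xl) ≡ - ((xi - xj) * (yk - yl) + (yi - yj) * (xk - xl))
    ring = solve-∀

  ⊕-Csym-flipʳ-cancel : ∀ A → (A ⊕ Csym i j k l) ⊕ Csym i j l k ≡ A
  ⊕-Csym-flipʳ-cancel A = ⊕-cancel A (Csym i j k l) (Csym i j l k) λ x y →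
    trans (entry-Csym i j l k x y) (trans (ring (δ x i) (δ x j) (δ x k) (δ x l) (δ y i) (δ y j) (δ y k) (δ y l))
                                          (cong -_ (sym (entry-Csym i j k l x y))))
    where
    ring : ∀ xi xj xk xl yi yj yk yl →
      (xi - xj) * (yl - yk) + (yi - yj) * (xl - xk) ≡ - ((xi - xj) * (yk - yl) + (yi - yj) * (xk - xl))
    ring = solve-∀

switch-edge : ∀ {n} {D : Vec ℕ n} {A : Matrix n} {i j k l : Fin n} →
              i ≢ j → k ≢ l → i ≢ k → i ≢ l → j ≢ k → j ≢ l →
              InM D A → InM D (A ⊕ Csym i j k l) → SymClosure (Arc D) A (A ⊕ Csym i j k l)
switch-edge {A = A} {i} {j} {k} {l} i≢j k≢l i≢k i≢l j≢k j≢l A∈M A'∈M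
  with FinP.<-cmp i j | FinP.<-cmp k l
... | tri≈ _ i≡j _ | _ = contradiction i≡j i≢j
... | _ | tri≈ _ k≡l _ = contradiction k≡l k≢l
... | tri< i<j _ _ | tri< k<l _ _ =
  fwd (A∈M , A'∈M , i , j , k , l , (i<j , k<l , i≢k , i≢l , j≢k , j≢l) , refl)
... | tri> _ _ j<i | tri> _ _ l<k =
  fwd (A∈M , A'∈M , j , i , l , k , (j<i , l<k , j≢l , j≢k , i≢l , i≢k) ,
       cong (A ⊕_) (sym (Csym-flip-both i j k l)))
... | tri> _ _ j<i | tri< k<l _ _ =
  bwd (A'∈M , A∈M , j , i , k , l , (j<i , k<l , j≢k , j≢l , i≢k , i≢l) , sym (⊕-Csym-flipˡ-cancel i j k l A))
... | tri< i<j _ _ | tri> _ _ l<k =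
  bwd (A'∈M , A∈M , i , j , l , k , (i<j , l<k , i≢l , i≢k , j≢l , j≢k) , sym (⊕-Csym-flipʳ-cancel i j k l A))

-- Acyclicity

index : ∀ {n} → Fin n → ℤ
index x = + toℕ x

index-gap : ∀ {n} {i j : Fin n} → i Fin.< j → ∃[ a ] index j ≡ index i + + ℕ.suc a
index-gap {i = i} i<j with ℕP.m≤n⇒∃[o]m+o≡n i<j
... | a , i+1+a≡j = a , cong +_ (sym (trans (ℕP.+-suc (toℕ i) a) i+1+a≡j))

potential : ∀ {n} → Matrix n → ℤ
potential A = sum λ x → sum λ y → entry A x y * (index x * index y)

potential-⊕ : ∀ {n} (A B : Matrix n) → potential (A ⊕ B) ≡ potential A + potential B
potential-⊕ A B =
  trans (sum-cong-≗ λ x → trans (sum-cong-≗ (split x)) (∑-distrib-+ (weighted A x) (weighted B x)))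
        (∑-distrib-+ (sum ∘ weighted A) (sum ∘ weighted B))
  where
  weighted : Matrix _ → Fin _ → Fin _ → ℤ
  weighted C x y = entry C x y * (index x * index y)
  split : ∀ x y → weighted (A ⊕ B) x y ≡ weighted A x y + weighted B x y
  split x y = trans (cong (_* (index x * index y)) (entry-⊕ A B x y)) (ℤP.*-distribʳ-+ _ (entry A x y) _)

potential-Csym : ∀ {n} (i j k l : Fin n) →
  potential (Csym i j k l) ≡ (index i - index j) * (index k - index l) + (index k - index l) * (index i - index j)
potential-Csym i j k l = begin
  potential (Csym i j k l)
    ≡⟨ sum-cong-≗ (λ x → trans (sum-cong-≗ (separate x)) (∑-distrib-+ (λ y → u x * v y) (λ y → v x * u y))) ⟩
  sum (λ x → sum (λ y → u x * v y) + sum (λ y → v x * u y))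
    ≡⟨ ∑-distrib-+ (λ x → sum (λ y → u x * v y)) (λ x → sum (λ y → v x * u y)) ⟩
  sum (λ x → sum (λ y → u x * v y)) + sum (λ x → sum (λ y → v x * u y))
    ≡⟨ cong₂ _+_ (∑∑-product u v) (∑∑-product v u) ⟩
  sum u * sum v + sum v * sum u
    ≡⟨ cong₂ (λ U V → U * V + V * U) (∑-dipole i j index) (∑-dipole k l index) ⟩
  (index i - index j) * (index k - index l) + (index k - index l) * (index i - index j)
    ∎
  where
  open ≡-Reasoning
  u v : Fin _ → ℤ
  u x = dipole i j x * index x
  v x = dipole k l x * index x
  separate : ∀ x y → entry (Csym i j k l) x y * (index x * index y) ≡ u x * v y + v x * u y
  separate x y = trans (cong (_* (index x * index y)) (entry-Csym i j k l x y))
                       (ring (dipole i j x) (dipole k l y) (dipole i j y) (dipole k l x) (index x) (index y))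
    where
    ring : ∀ a b c d p q → (a * b + c * d) * (p * q) ≡ (a * p) * (b * q) + (d * p) * (c * q)
    ring = solve-∀

potential-Csym-positive : ∀ {n} {i j k l : Fin n} → i Fin.< j → k Fin.< l → + 0 < potential (Csym i j k l)
potential-Csym-positive {i = i} {j} {k} {l} i<j k<l with index-gap i<j | index-gap k<l
... | a , j≡i+a | b , l≡k+b = subst (+ 0 <_) (sym (trans (potential-Csym i j k l) by-gaps)) (+<+ (ℕ.s≤s ℕ.z≤n))
  where
  gain : ℤ → ℤ → ℤ
  gain J L = (index i - J) * (index k - L) + (index k - L) * (index i - J)
  ring : ∀ I K A B → (I - (I + A)) * (K - (K + B)) + (K - (K + B)) * (I - (I + A)) ≡ A * B + B * A
  ring = solve-∀
  by-gaps : gain (index j) (index l) ≡ + ℕ.suc a * + ℕ.suc b + + ℕ.suc b * + ℕ.suc a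
  by-gaps = trans (cong₂ gain j≡i+a l≡k+b) (ring (index i) (index k) (+ ℕ.suc a) (+ ℕ.suc b))

potential-increases : ∀ {n} {D : Vec ℕ n} {A A'} → Arc D A A' → potential A < potential A'
potential-increases {A = A} (_ , _ , i , j , k , l , (i<j , k<l , _) , refl) =
  subst₂ _<_ (ℤP.+-identityʳ (potential A)) (sym (potential-⊕ A (Csym i j k l)))
         (ℤP.+-monoʳ-< (potential A) (potential-Csym-positive i<j k<l))

potential-increases⁺ : ∀ {n} {D : Vec ℕ n} {A A'} → TransClosure (Arc D) A A' → potential A < potential A'
potential-increases⁺ {D = D} [ arc ] = potential-increases {D = D} arc
potential-increases⁺ {D = D} (arc ∷ arcs) =
  ℤP.<-trans (potential-increases {D = D} arc) (potential-increases⁺ {D = D} arcs)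

acyclic : ∀ {n} (D : Vec ℕ n) → Acyclic D
acyclic D A cycle = ℤP.<-irrefl refl (potential-increases⁺ {D = D} cycle)

-- Connectivity

-- Csym p t s q removes the edges pq, st and adds the edges ps, qt.
module Switch {n} {D : Vec ℕ n} {X : Matrix n} (X∈M : InM D X) {p q s t : Fin n} (p≢s : p ≢ s) (q≢t : q ≢ t)
              (Xpq≡1 : entry X p q ≡ + 1) (Xst≡1 : entry X s t ≡ + 1)
              (Xps≡0 : entry X p s ≡ + 0) (Xqt≡0 : entry X q t ≡ + 0) where

  open Member {D = D} {A = X} X∈M

  switched : Matrix n
  switched = X ⊕ Csym p t s q

  p≢q : p ≢ q
  p≢q = ≢-by-values (entry X p) (diagonal p) Xpq≡1 0≢1

  s≢t : s ≢ t
  s≢t = ≢-by-values (entry X s) (diagonal s) Xst≡1 0≢1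

  p≢t : p ≢ t
  p≢t = ≢-by-values (entry X q) (trans (symmetric q p) Xpq≡1) Xqt≡0 (λ ())

  s≢q : s ≢ q
  s≢q = ≢-by-values (λ x → entry X x t) Xst≡1 Xqt≡0 (λ ())

  data Position (x : Fin n) : Set where
    at-p : x ≡ p → Position x
    at-q : x ≡ q → Position x
    at-s : x ≡ s → Position x
    at-t : x ≡ t → Position x
    elsewhere : x ≢ p → x ≢ q → x ≢ s → x ≢ t → Position x

  position : ∀ x → Position x
  position x with x FinP.≟ p | x FinP.≟ q | x FinP.≟ s | x FinP.≟ t
  ... | yes x≡p | _ | _ | _ = at-p x≡p
  ... | no _ | yes x≡q | _ | _ = at-q x≡q
  ... | no _ | no _ | yes x≡s | _ = at-s x≡s
  ... | no _ | no _ | no _ | yes x≡t = at-t x≡t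
  ... | no x≢p | no x≢q | no x≢s | no x≢t = elsewhere x≢p x≢q x≢s x≢t

  Profile : Set
  Profile = ℤ × ℤ × ℤ × ℤ

  profile : ∀ {x} → Position x → Profile
  profile (at-p _) = + 1 , + 0 , + 0 , + 0
  profile (at-q _) = + 0 , + 1 , + 0 , + 0
  profile (at-s _) = + 0 , + 0 , + 1 , + 0
  profile (at-t _) = + 0 , + 0 , + 0 , + 1
  profile (elsewhere _ _ _ _) = + 0 , + 0 , + 0 , + 0

  profile-≡ : ∀ {a b c d a' b' c' d' : ℤ} → a ≡ a' → b ≡ b' → c ≡ c' → d ≡ d' →
              (a , b , c , d) ≡ (a' , b' , c' , d')
  profile-≡ refl refl refl refl = refl

  profile-δ : ∀ {x} (c : Position x) → (δ x p , δ x q , δ x s , δ x t) ≡ profile c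
  profile-δ (at-p refl) = profile-≡ (δ-refl p) (δ-≢ p≢q) (δ-≢ p≢s) (δ-≢ p≢t)
  profile-δ (at-q refl) = profile-≡ (δ-≢ (p≢q ∘ sym)) (δ-refl q) (δ-≢ (s≢q ∘ sym)) (δ-≢ q≢t)
  profile-δ (at-s refl) = profile-≡ (δ-≢ (p≢s ∘ sym)) (δ-≢ s≢q) (δ-refl s) (δ-≢ s≢t)
  profile-δ (at-t refl) = profile-≡ (δ-≢ (p≢t ∘ sym)) (δ-≢ (q≢t ∘ sym)) (δ-≢ (s≢t ∘ sym)) (δ-refl t)
  profile-δ (elsewhere x≢p x≢q x≢s x≢t) = profile-≡ (δ-≢ x≢p) (δ-≢ x≢q) (δ-≢ x≢s) (δ-≢ x≢t)

  change : Profile → Profile → ℤ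
  change (xp , xq , xs , xt) (yp , yq , ys , yt) = (xp - xt) * (ys - yq) + (yp - yt) * (xs - xq)

  entry-switched : ∀ {x y} (cx : Position x) (cy : Position y) →
                   entry switched x y ≡ entry X x y + change (profile cx) (profile cy)
  entry-switched {x} {y} cx cy =
    trans (entry-⊕-Csym X p t s q x y) (cong (_+_ (entry X x y)) (cong₂ change (profile-δ cx) (profile-δ cy)))

  module _ {x y : Fin n} where

    kept : entry switched x y ≡ entry X x y + + 0 → Bit (entry switched x y)
    kept new≡old = Sum.map (trans new≡old′) (trans new≡old′) (bit x y)
      where new≡old′ = trans new≡old (ℤP.+-identityʳ _)

    removed : entry switched x y ≡ entry X x y + - + 1 → entry X x y ≡ + 1 → Bit (entry switched x y)
    removed new≡old old≡1 = inj₁ (trans new≡old (cong (_+ - + 1) old≡1))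

    added : entry switched x y ≡ entry X x y + + 1 → entry X x y ≡ + 0 → Bit (entry switched x y)
    added new≡old old≡0 = inj₂ (trans new≡old (cong (_+ + 1) old≡0))

  switched-bit : ∀ {x y} → Position x → Position y → Bit (entry switched x y)
  switched-bit cx@(at-p refl) cy@(at-p refl) = kept (entry-switched cx cy)
  switched-bit cx@(at-p refl) cy@(at-q refl) = removed (entry-switched cx cy) Xpq≡1
  switched-bit cx@(at-p refl) cy@(at-s refl) = added (entry-switched cx cy) Xps≡0
  switched-bit cx@(at-p refl) cy@(at-t refl) = kept (entry-switched cx cy)
  switched-bit cx@(at-p refl) cy@(elsewhere _ _ _ _) = kept (entry-switched cx cy)
  switched-bit cx@(at-q refl) cy@(at-p refl) = removed (entry-switched cx cy) (trans (symmetric q p) Xpq≡1)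
  switched-bit cx@(at-q refl) cy@(at-q refl) = kept (entry-switched cx cy)
  switched-bit cx@(at-q refl) cy@(at-s refl) = kept (entry-switched cx cy)
  switched-bit cx@(at-q refl) cy@(at-t refl) = added (entry-switched cx cy) Xqt≡0
  switched-bit cx@(at-q refl) cy@(elsewhere _ _ _ _) = kept (entry-switched cx cy)
  switched-bit cx@(at-s refl) cy@(at-p refl) = added (entry-switched cx cy) (trans (symmetric s p) Xps≡0)
  switched-bit cx@(at-s refl) cy@(at-q refl) = kept (entry-switched cx cy)
  switched-bit cx@(at-s refl) cy@(at-s refl) = kept (entry-switched cx cy)
  switched-bit cx@(at-s refl) cy@(at-t refl) = removed (entry-switched cx cy) Xst≡1
  switched-bit cx@(at-s refl) cy@(elsewhere _ _ _ _) = kept (entry-switched cx cy)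
  switched-bit cx@(at-t refl) cy@(at-p refl) = kept (entry-switched cx cy)
  switched-bit cx@(at-t refl) cy@(at-q refl) = added (entry-switched cx cy) (trans (symmetric t q) Xqt≡0)
  switched-bit cx@(at-t refl) cy@(at-s refl) = removed (entry-switched cx cy) (trans (symmetric t s) Xst≡1)
  switched-bit cx@(at-t refl) cy@(at-t refl) = kept (entry-switched cx cy)
  switched-bit cx@(at-t refl) cy@(elsewhere _ _ _ _) = kept (entry-switched cx cy)
  switched-bit cx@(elsewhere _ _ _ _) cy@(at-p refl) = kept (entry-switched cx cy)
  switched-bit cx@(elsewhere _ _ _ _) cy@(at-q refl) = kept (entry-switched cx cy)
  switched-bit cx@(elsewhere _ _ _ _) cy@(at-s refl) = kept (entry-switched cx cy)
  switched-bit cx@(elsewhere _ _ _ _) cy@(at-t refl) = kept (entry-switched cx cy)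
  switched-bit cx@(elsewhere _ _ _ _) cy@(elsewhere _ _ _ _) = kept (entry-switched cx cy)

  switched-diagonal : ∀ {x} → Position x → entry switched x x ≡ + 0
  switched-diagonal {x} cx =
    trans (entry-switched cx cx) (trans (cong (_+_ (entry X x x)) (no-loop cx)) (trans (ℤP.+-identityʳ _) (diagonal x)))
    where
    no-loop : ∀ {x} (cx : Position x) → change (profile cx) (profile cx) ≡ + 0
    no-loop (at-p _) = refl
    no-loop (at-q _) = refl
    no-loop (at-s _) = refl
    no-loop (at-t _) = refl
    no-loop (elsewhere _ _ _ _) = refl

  switched∈M : InM D switched
  switched∈M = (λ x y → switched-bit (position x) (position y))
             , ⊕-Csym-sym {A = X} symmetric p t s q
             , (λ x → switched-diagonal (position x))
             , (λ x → trans (rowSum≡∑ (lookup switched x)) (trans (⊕-Csym-rowSum X p t s q x) (degree x)))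

  switched-edge : SymClosure (Arc D) X switched
  switched-edge = switch-edge {D = D} p≢t s≢q p≢s p≢q (s≢t ∘ sym) (q≢t ∘ sym) X∈M switched∈M

  switched-unchanged : ∀ {x y} → csym p t s q x y ≡ + 0 → entry switched x y ≡ entry X x y
  switched-unchanged {x} {y} c≡0 =
    trans (entry-⊕-Csym X p t s q x y) (trans (cong (_+_ (entry X x y)) c≡0) (ℤP.+-identityʳ _))

  switched-outside : ∀ x y → x ≢ p → x ≢ q → x ≢ s → x ≢ t → entry switched x y ≡ entry X x y
  switched-outside x y x≢p x≢q x≢s x≢t =
    switched-unchanged (csym-outside-row p t s q x y (dipole-outside x≢p x≢t) (dipole-outside x≢s x≢q))

  switched-row-p : ∀ y → y ≢ q → y ≢ s → entry switched p y ≡ entry X p y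
  switched-row-p y y≢q y≢s =
    switched-unchanged (csym-outside-pair p t s q p y (dipole-outside p≢s p≢q) (dipole-outside y≢s y≢q))

  switched-pq : entry switched p q ≡ + 0
  switched-pq = trans (entry-switched (at-p refl) (at-q refl)) (cong (_+ - + 1) Xpq≡1)

  switched-ps : entry switched p s ≡ + 1
  switched-ps = trans (entry-switched (at-p refl) (at-s refl)) (cong (_+ + 1) Xps≡0)

module Connectivity {n} (D : Vec ℕ n) where

  Linked : Matrix n → Matrix n → Set
  Linked = Star (SymClosure (Arc D))

  AgreeBelow : ℕ → Matrix n → Matrix n → Set
  AgreeBelow m A B = ∀ x y → toℕ x ℕ.< m → entry A x y ≡ entry B x y

  rowDistance : Fin n → Matrix n → Matrix n → ℕ
  rowDistance r A B = hamming (entry A r) (entry B r)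

  record Closer (m : ℕ) (r : Fin n) (A B : Matrix n) : Set where
    field
      {A' B'}  : Matrix n
      A'∈M     : InM D A'
      B'∈M     : InM D B'
      A~A'     : Linked A A'
      B~B'     : Linked B B'
      agree    : AgreeBelow m A' B'
      closer   : rowDistance r A' B' ℕ.< rowDistance r A B

  Closer-sym : ∀ {m r A B} → Closer m r A B → Closer m r B A
  Closer-sym {r = r} {A} {B} c = record
    { A'∈M = B'∈M ; B'∈M = A'∈M ; A~A' = B~B' ; B~B' = A~A'
    ; agree = λ x y x<m → sym (agree x y x<m)
    ; closer = subst₂ ℕ._<_ (hamming-comm (entry A' r) (entry B' r)) (hamming-comm (entry A r) (entry B r)) closer
    }
    where open Closer c

  switch-toward : ∀ {m} {X Y : Matrix n} → InM D X → InM D Y → AgreeBelow m X Y → ∀ {r b c d} →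
    m ℕ.≤ toℕ r → m ℕ.≤ toℕ b → m ℕ.≤ toℕ c → m ℕ.≤ toℕ d → b ≢ d →
    entry X r b ≡ + 1 → entry X r c ≡ + 0 → entry Y r b ≡ + 0 → entry Y r c ≡ + 1 →
    entry X c d ≡ + 1 → entry X b d ≡ + 0 →
    Closer m r X Y
  switch-toward {m} {X} {Y} X∈M Y∈M agree {r} {b} {c} {d} m≤r m≤b m≤c m≤d b≢d
                Xrb≡1 Xrc≡0 Yrb≡0 Yrc≡1 Xcd≡1 Xbd≡0 =
    record { A'∈M = switched∈M ; B'∈M = Y∈M ; A~A' = switched-edge ◅ ε ; B~B' = ε
           ; agree = agree′ ; closer = closer′ }
    where
    r≢c : r ≢ c
    r≢c = ≢-by-values (entry Y r) (Member.diagonal {D = D} {A = Y} Y∈M r) Yrc≡1 0≢1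
    open Switch {D = D} {X = X} X∈M r≢c b≢d Xrb≡1 Xcd≡1 Xrc≡0 Xbd≡0
    below : ∀ {x y} → toℕ x ℕ.< m → m ℕ.≤ toℕ y → x ≢ y
    below x<m m≤y refl = ℕP.<-irrefl refl (ℕP.<-≤-trans x<m m≤y)
    agree′ : AgreeBelow m switched Y
    agree′ x y x<m =
      trans (switched-outside x y (below x<m m≤r) (below x<m m≤b) (below x<m m≤c) (below x<m m≤d)) (agree x y x<m)
    closer′ : rowDistance r switched Y ℕ.< rowDistance r X Y
    closer′ = hamming-repair switched-row-p (trans switched-pq (sym Yrb≡0)) (trans switched-ps (sym Yrc≡1))
                             (1≢0-at Xrb≡1 Yrb≡0)

  module _ {A B : Matrix n} (A∈M : InM D A) (B∈M : InM D B) where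
    private
      module A = Member {D = D} {A = A} A∈M
      module B = Member {D = D} {A = B} B∈M

    disagreement-not-below : ∀ {m} → AgreeBelow m A B → ∀ {r y} →
                             entry A r y ≢ entry B r y → m ℕ.≤ toℕ y
    disagreement-not-below {m} agree {r} {y} differ with toℕ y ℕ.<? m
    ... | yes y<m = contradiction (trans (A.symmetric r y) (trans (agree y r y<m) (B.symmetric y r))) differ
    ... | no y≮m = ℕP.≮⇒≥ y≮m

    -- Otherwise h d = (A b d - A c d) + (B c d - B b d) would be non-negative off {r, b, c},
    -- with h b + h c = 0 and h r = 2, although its sum is (deg b - deg c) + (deg c - deg b) = 0.
    switch-partner : ∀ {m} → AgreeBelow m A B → ∀ {r b c} →
      entry A r b ≡ + 1 → entry A r c ≡ + 0 → entry B r b ≡ + 0 → entry B r c ≡ + 1 →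
      ∃[ d ] (m ℕ.≤ toℕ d × ((d ≢ b × entry A c d ≡ + 1 × entry A b d ≡ + 0) ⊎
                             (d ≢ c × entry B b d ≡ + 1 × entry B c d ≡ + 0)))
    switch-partner {m} agree {r} {b} {c} Arb≡1 Arc≡0 Brb≡0 Brc≡1
      with FinP.any? (λ d → (m ℕ.≤? toℕ d) ×-dec
                              ((¬? (d FinP.≟ b) ×-dec (entry A c d ℤP.≟ + 1) ×-dec (entry A b d ℤP.≟ + 0)) ⊎-dec
                               (¬? (d FinP.≟ c) ×-dec (entry B b d ℤP.≟ + 1) ×-dec (entry B c d ℤP.≟ + 0))))
    ... | yes found = found
    ... | no none =
      contradiction (subst₂ _≤_ h-at-r ∑h≡0 (point≤∑-merging h b≢c r≢b r≢c h-bc h-nonneg)) λ { (+≤+ ()) }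
      where
      h : Fin n → ℤ
      h d = (entry A b d - entry A c d) + (entry B c d - entry B b d)
      r≢b : r ≢ b
      r≢b = ≢-by-values (entry A r) (A.diagonal r) Arb≡1 0≢1
      r≢c : r ≢ c
      r≢c = ≢-by-values (entry B r) (B.diagonal r) Brc≡1 0≢1
      b≢c : b ≢ c
      b≢c = ≢-by-values (entry A r) Arb≡1 Arc≡0 (λ ())
      ∑h≡0 : sum h ≡ + 0
      ∑h≡0 = begin
        sum h
          ≡⟨ ∑-distrib-+ (λ d → entry A b d - entry A c d) (λ d → entry B c d - entry B b d) ⟩
        sum (λ d → entry A b d - entry A c d) + sum (λ d → entry B c d - entry B b d)
          ≡⟨ cong₂ _+_ (∑-distrib-- (entry A b) (entry A c)) (∑-distrib-- (entry B c) (entry B b)) ⟩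
        (sum (entry A b) - sum (entry A c)) + (sum (entry B c) - sum (entry B b))
          ≡⟨ cong₂ _+_ (cong₂ _-_ (A.degree b) (A.degree c)) (cong₂ _-_ (B.degree c) (B.degree b)) ⟩
        (+ lookup D b - + lookup D c) + (+ lookup D c - + lookup D b)
          ≡⟨ ring (+ lookup D b) (+ lookup D c) ⟩
        + 0 ∎
        where
        open ≡-Reasoning
        ring : ∀ x y → (x - y) + (y - x) ≡ + 0
        ring = solve-∀
      h-at-r : h r ≡ + 2
      h-at-r = cong₂ _+_ (cong₂ _-_ (trans (A.symmetric b r) Arb≡1) (trans (A.symmetric c r) Arc≡0))
                         (cong₂ _-_ (trans (B.symmetric c r) Brc≡1) (trans (B.symmetric b r) Brb≡0))
      h-bc : + 0 ≤ h b + h c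
      h-bc = ℤP.≤-reflexive (sym (cancel (A.diagonal b) (B.diagonal b) (A.diagonal c) (B.diagonal c)
                                        (A.symmetric c b) (B.symmetric c b)))
        where
        cancel : ∀ {abb acb bcb bbb abc acc bcc bbc : ℤ} → abb ≡ + 0 → bbb ≡ + 0 → acc ≡ + 0 → bcc ≡ + 0 →
                 acb ≡ abc → bcb ≡ bbc → ((abb - acb) + (bcb - bbb)) + ((abc - acc) + (bcc - bbc)) ≡ + 0
        cancel {acb = x} {bcb = y} refl refl refl refl refl refl = ring x y
          where
          ring : ∀ x y → ((+ 0 - x) + (y - + 0)) + ((x - + 0) + (+ 0 - y)) ≡ + 0
          ring = solve-∀
      h-nonneg : ∀ d → d ≢ r → d ≢ b → d ≢ c → + 0 ≤ h d
      h-nonneg d _ d≢b d≢c with toℕ d ℕ.<? m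
      ... | yes d<m =
        ℤP.≤-reflexive (sym (trans (cong₂ (λ x y → (x - y) + (entry B c d - entry B b d)) (same b) (same c))
                                   (ring (entry B b d) (entry B c d))))
        where
        same : ∀ x → entry A x d ≡ entry B x d
        same x = trans (A.symmetric x d) (trans (agree d x d<m) (B.symmetric d x))
        ring : ∀ x y → (x - y) + (y - x) ≡ + 0
        ring = solve-∀
      ... | no d≮m = ℤP.+-mono-≤
        (bit-difference-nonneg (A.bit b d) (A.bit c d)
          λ (Abd≡0 , Acd≡1) → none (d , ℕP.≮⇒≥ d≮m , inj₁ (d≢b , Acd≡1 , Abd≡0)))
        (bit-difference-nonneg (B.bit c d) (B.bit b d)
          λ (Bcd≡0 , Bbd≡1) → none (d , ℕP.≮⇒≥ d≮m , inj₂ (d≢c , Bbd≡1 , Bcd≡0)))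

    closer-at : ∀ {m r b} → AgreeBelow m A B → toℕ r ≡ m → entry A r b ≡ + 1 → entry B r b ≡ + 0 →
                Closer m r A B
    closer-at {m} {r} {b} agree r≡m Arb≡1 Brb≡0
      with opposite-bit (entry A r) (entry B r) (A.bit r) (B.bit r) (trans (A.degree r) (sym (B.degree r)))
                        Arb≡1 Brb≡0
    ... | c , Arc≡0 , Brc≡1 with switch-partner agree Arb≡1 Arc≡0 Brb≡0 Brc≡1
    ... | d , m≤d , inj₁ (d≢b , Acd≡1 , Abd≡0) =
      switch-toward A∈M B∈M agree (ℕP.≤-reflexive (sym r≡m))
        (disagreement-not-below agree (1≢0-at Arb≡1 Brb≡0))
        (disagreement-not-below agree (1≢0-at Brc≡1 Arc≡0 ∘ sym)) m≤d
        (d≢b ∘ sym) Arb≡1 Arc≡0 Brb≡0 Brc≡1 Acd≡1 Abd≡0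
    ... | d , m≤d , inj₂ (d≢c , Bbd≡1 , Bcd≡0) = Closer-sym
      (switch-toward B∈M A∈M (λ x y x<m → sym (agree x y x<m)) (ℕP.≤-reflexive (sym r≡m))
        (disagreement-not-below agree (1≢0-at Brc≡1 Arc≡0 ∘ sym))
        (disagreement-not-below agree (1≢0-at Arb≡1 Brb≡0)) m≤d
        (d≢c ∘ sym) Brc≡1 Brb≡0 Arc≡0 Arb≡1 Bbd≡1 Bcd≡0)

  row-step : ∀ {m r A B} → InM D A → InM D B → AgreeBelow m A B → toℕ r ≡ m →
             (∀ y → entry A r y ≡ entry B r y) ⊎ Closer m r A B
  row-step {r = r} {A} {B} A∈M B∈M agree r≡m
    with FinP.all? (λ y → entry A r y ℤP.≟ entry B r y)
  ... | yes same = inj₁ same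
  ... | no differ with FinP.¬∀⟶∃¬ n _ (λ y → entry A r y ℤP.≟ entry B r y) differ
  ...   | y , Ary≢Bry with Member.bit {D = D} {A = A} A∈M r y | Member.bit {D = D} {A = B} B∈M r y
  ...     | inj₁ Ary≡0 | inj₁ Bry≡0 = contradiction (trans Ary≡0 (sym Bry≡0)) Ary≢Bry
  ...     | inj₂ Ary≡1 | inj₂ Bry≡1 = contradiction (trans Ary≡1 (sym Bry≡1)) Ary≢Bry
  ...     | inj₂ Ary≡1 | inj₁ Bry≡0 = inj₂ (closer-at A∈M B∈M agree r≡m Ary≡1 Bry≡0)
  ...     | inj₁ Ary≡0 | inj₂ Bry≡1 =
    inj₂ (Closer-sym (closer-at {A = B} {B = A} B∈M A∈M (λ x y x<m → sym (agree x y x<m)) r≡m Bry≡1 Ary≡0))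

  agree-suc : ∀ {m r A B} → toℕ r ≡ m → AgreeBelow m A B → (∀ y → entry A r y ≡ entry B r y) →
              AgreeBelow (ℕ.suc m) A B
  agree-suc r≡m agree same x y x<1+m with ℕP.m<1+n⇒m<n∨m≡n x<1+m
  ... | inj₁ x<m = agree x y x<m
  ... | inj₂ x≡m with FinP.toℕ-injective (trans x≡m (sym r≡m))
  ...   | refl = same y

  linked-by-row : ∀ fuel {m r A B} → toℕ r ≡ m → rowDistance r A B ℕ.< fuel →
    (∀ {A B} → InM D A → InM D B → AgreeBelow (ℕ.suc m) A B → Linked A B) →
    InM D A → InM D B → AgreeBelow m A B → Linked A B
  linked-by-row (ℕ.suc fuel) {A = A} {B} r≡m distance<fuel next A∈M B∈M agree
    with row-step A∈M B∈M agree r≡m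
  ... | inj₁ same = next A∈M B∈M (agree-suc {A = A} {B = B} r≡m agree same)
  ... | inj₂ c =
    A~A' ◅◅ linked-by-row fuel r≡m (ℕP.<-≤-trans closer (ℕ.s≤s⁻¹ distance<fuel)) next A'∈M B'∈M agree′
         ◅◅ reverse (SymClosure.symmetric (Arc D)) B~B'
    where open Closer c renaming (agree to agree′)

  linked-from : ∀ k {m} → k ℕ.+ m ≡ n → ∀ {A B} → InM D A → InM D B → AgreeBelow m A B → Linked A B
  linked-from ℕ.zero refl A∈M B∈M agree = subst (Linked _) (≡-by-entries λ x y → agree x y (FinP.toℕ<n x)) ε
  linked-from (ℕ.suc k) {m} 1+k+m≡n {A} {B} A∈M B∈M =
    linked-by-row (ℕ.suc (rowDistance r A B)) (FinP.toℕ-fromℕ< m<n) ℕP.≤-refl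
                  (linked-from k (trans (ℕP.+-suc k m) 1+k+m≡n)) A∈M B∈M
    where
    m<n : m ℕ.< n
    m<n = subst (m ℕ.<_) 1+k+m≡n (ℕ.s≤s (ℕP.m≤n+m m k))
    r : Fin n
    r = Fin.fromℕ< m<n

  connected : Connected D
  connected A B A∈M B∈M = linked-from n (ℕP.+-identityʳ n) A∈M B∈M λ _ _ ()

proposition4 : (n : ℕ) (D : Vec ℕ n) → NonIncreasing D → Graphical D →
                 Connected D × Acyclic D
proposition4 n D _ _ = Connectivity.connected D , acyclic D
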